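{- There is an absolute constant $c>0$ such that the following holds. For any $\varepsilon>0$ there is a $\delta=\delta(\varepsilon)\ge c\varepsilon$ (i.e. $\delta=\Omega(\varepsilon)$) such that for every $n$-vertex graph $G$, if $\mathrm{itm}(G)<(1-\varepsilon)\frac{n}{3}$, then $\log\mathrm{mis}(G)<\left(\frac{1}{3}\log 3-\delta\right)n$.
   Context: $\mathrm{mis}(G)$ denotes the number of maximal independent sets of $G$, and $\log=\log_2$. An induced triangle matching of $G$ is an induced subgraph of $G$ that is a vertex-disjoint union of triangles; $\mathrm{itm}(G)$ is the number of triangles in a largest induced triangle matching of $G$.
   Formalization: The parameter ε ranges over the positive rationals, and the constants c and δ are taken in the rationals. -}

module Defs where

open import Data.Nat using (ℕ; zero; suc; _+_; _*_; _∸_; _^_; _<_; _≤_)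
open import Data.Bool using (Bool; true; false; not; _∧_; _∨_; if_then_else_)
open import Data.Fin using (Fin)
open import Data.Vec using (Vec; []; _∷_; lookup; _[_]≔_)
open import Data.List.Base using (List; []; _∷_; allFin)
open import Relation.Binary.PropositionalEquality using (_≡_)
open import Relation.Nullary using (¬_)
open import Data.Product using (_×_)

record Graph (n : ℕ) : Set where
  field
    adj    : Fin n → Fin n → Bool
    sym    : ∀ i j → adj i j ≡ adj j i
    irrefl : ∀ i → adj i i ≡ false
open Graph public

all : ∀ {A : Set} → (A → Bool) → List A → Bool
all p []       = true
all p (x ∷ xs) = p x ∧ all p xs

VSet : ℕ → Set
VSet n = Vec Bool n

isIndependent : ∀ {n} → Graph n → VSet n → Bool
isIndependent {n} G S =
  all (λ i → all (λ j → not (lookup S i ∧ lookup S j ∧ adj G i j)) (allFin n)) (allFin n)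

isMIS : ∀ {n} → Graph n → VSet n → Bool
isMIS {n} G S =
  isIndependent G S ∧
  all (λ v → lookup S v ∨ not (isIndependent G (S [ v ]≔ true))) (allFin n)

countSubsets : ∀ {n} → (VSet n → Bool) → ℕ
countSubsets {zero}  P = if P [] then 1 else 0
countSubsets {suc n} P = countSubsets (λ S → P (true ∷ S)) + countSubsets (λ S → P (false ∷ S))

mis : ∀ {n} → Graph n → ℕ
mis G = countSubsets (isMIS G)

-- An induced triangle matching of G with k triangles: triangles
-- tri a (a : Fin k) with vertices tri a 0, tri a 1, tri a 2, all 3k
-- vertices distinct, each triple spanning a triangle, and no edges
-- between different triangles (so the induced subgraph on these 3k
-- vertices is exactly the disjoint union of the k triangles).
record InducedTriangleMatching {n : ℕ} (G : Graph n) (k : ℕ) : Set where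
  field
    tri      : Fin k → Fin 3 → Fin n
    distinct : ∀ a i b j → tri a i ≡ tri b j → (a ≡ b) × (i ≡ j)
    inside   : ∀ a i j → ¬ (i ≡ j) → adj G (tri a i) (tri a j) ≡ true
    between  : ∀ a b i j → ¬ (a ≡ b) → adj G (tri a i) (tri b j) ≡ false

IsItm : ∀ {n} → Graph n → ℕ → Set
IsItm G t = InducedTriangleMatching G t × (∀ k → InducedTriangleMatching G k → k ≤ t)

module Submission where

-- Theorem 1.3 with c = 1/73 and δ = ε/73.  For a vertex set U and t bounding the
-- induced triangle matchings inside U we prove, by induction on |U|,
--     mis(G[U]) ≤ 3^t (10/7)^(|U| − 3t).
-- Take v of minimum degree d in G[U].  Every MIS S meets N[v], and if u ∈ S then
-- S ∖ {u} is a MIS of G[U ∖ N[u]], which has deg(u) + 1 ≥ d + 1 fewer vertices.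
-- For d ≠ 2 these d+1 branches suffice since (d+1)(7/10)^(d+1) ≤ 1.  For d = 2 with
-- N(v) = {x, y}: a neighbour of degree ≥ 3 gives branches deleting 3, 3, 4 vertices;
-- an induced path with deg x = 2 gives branches x ∈ S, v ∈ S, {y, z} ⊆ S deleting
-- 3, 3, 5; otherwise v x y is an isolated triangle, mis triples and itm drops by 1.
-- Finally n = 3t + m with m > εn, and mis(G) ≤ 3^t (10/7)^m gives the logarithmic
-- bound via 8 · 1000^73 ≤ 1029^73.  The file develops Boolean and counting lemmas,
-- MISs of induced subgraphs and deletion of closed neighbourhoods, the arithmetic
-- of combining branches, the induction, and the final estimate.

open import Defs hiding (sym)
open import Data.Nat using (ℕ; zero; suc; _+_; _*_; _∸_; _^_; _<_; _≤_; z≤n; s≤s; NonZero)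
open import Data.Nat.Properties
open import Data.Nat.Tactic.RingSolver using (solve-∀)
open import Data.Bool using (Bool; true; false; not; _∧_; _∨_; if_then_else_; T)
open import Data.Bool.Properties using (T?; T-∧; T-∨; ∧-assoc; ∧-zeroʳ; ∧-identityʳ)
open import Data.Bool.ListAction using (any)
open import Data.Fin using (Fin; zero; suc) renaming (_≟_ to _≟ᶠ_)
open import Data.Fin.Properties using () renaming (suc-injective to Fin-suc-injective)
open import Data.Vec using ([]; _∷_; lookup; _[_]≔_; replicate; tabulate)
open import Data.Vec.Properties using (lookup∘tabulate; lookup∘update; lookup∘update′; lookup-replicate)
open import Data.List.Base using ([]; _∷_; allFin)
open import Data.List.Membership.Propositional using (_∈_)
open import Data.List.Membership.Propositional.Properties using (∈-allFin)
open import Data.List.Relation.Unary.Any using (here; there)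
open import Data.Product using (Σ; ∃; _×_; _,_; proj₁; proj₂)
open import Data.Sum using (_⊎_; inj₁; inj₂; swap)
open import Data.Empty using (⊥; ⊥-elim)
open import Data.Unit using (tt)
open import Function using (_∘_)
open import Function.Bundles using (Equivalence)
open import Relation.Nullary using (¬_; Dec; yes; no)
open import Relation.Nullary.Decidable using (⌊_⌋; toWitness; fromWitness)
open import Relation.Binary.PropositionalEquality
  using (_≡_; _≢_; refl; sym; trans; cong; cong₂; subst; subst₂; module ≡-Reasoning)

open Equivalence using (to; from)

T-∧-intro : ∀ {x y} → T x → T y → T (x ∧ y)
T-∧-intro {x} {y} p q = from (T-∧ {x} {y}) (p , q)

T-∧-fst : ∀ {x y} → T (x ∧ y) → T x
T-∧-fst {x} {y} p = proj₁ (to (T-∧ {x} {y}) p)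

T-∧-snd : ∀ {x y} → T (x ∧ y) → T y
T-∧-snd {x} {y} p = proj₂ (to (T-∧ {x} {y}) p)

T-∨-elim : ∀ {x y} → T (x ∨ y) → T x ⊎ T y
T-∨-elim {x} {y} = to (T-∨ {x} {y})

T-∨-inl : ∀ {x y} → T x → T (x ∨ y)
T-∨-inl {x} {y} p = from (T-∨ {x} {y}) (inj₁ p)

T-∨-inr : ∀ {x y} → T y → T (x ∨ y)
T-∨-inr {x} {y} p = from (T-∨ {x} {y}) (inj₂ p)

T-not-intro : ∀ {x} → ¬ T x → T (not x)
T-not-intro {false} _ = tt
T-not-intro {true}  p = p tt

T-not-elim : ∀ {x} → T (not x) → ¬ T x
T-not-elim {false} _ ()

T-not-not : ∀ {x} → ¬ T (not x) → T x
T-not-not {true}  _ = tt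
T-not-not {false} p = p tt

T-≡-true : ∀ {x} → T x → x ≡ true
T-≡-true {true} _ = refl

T-≡-false : ∀ {x} → ¬ T x → x ≡ false
T-≡-false {false} _ = refl
T-≡-false {true}  p = ⊥-elim (p tt)

T-cast : ∀ {x y : Bool} → x ≡ y → T x → T y
T-cast refl p = p

_==_ : ∀ {n} → Fin n → Fin n → Bool
i == j = ⌊ i ≟ᶠ j ⌋

==-sound : ∀ {n} {i j : Fin n} → T (i == j) → i ≡ j
==-sound = toWitness

==-refl : ∀ {n} (i : Fin n) → T (i == i)
==-refl i = fromWitness refl

all⁻ : ∀ {A : Set} (p : A → Bool) {xs} → T (all p xs) → ∀ {x} → x ∈ xs → T (p x)
all⁻ p {y ∷ _} h (here refl) = T-∧-fst {p y} h
all⁻ p {y ∷ _} h (there m)   = all⁻ p (T-∧-snd {p y} h) m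

all⁺ : ∀ {A : Set} (p : A → Bool) xs → (∀ x → T (p x)) → T (all p xs)
all⁺ p []       h = tt
all⁺ p (y ∷ xs) h = T-∧-intro (h y) (all⁺ p xs h)

all-counterexample : ∀ {A : Set} (p : A → Bool) xs → ¬ T (all p xs) → ∃ λ x → ¬ T (p x)
all-counterexample p []       h = ⊥-elim (h tt)
all-counterexample p (y ∷ xs) h with T? (p y)
... | no  q = y , q
... | yes q = all-counterexample p xs (λ r → h (T-∧-intro q r))

allFin⁻ : ∀ {n} (p : Fin n → Bool) → T (all p (allFin n)) → ∀ i → T (p i)
allFin⁻ p h i = all⁻ p h (∈-allFin i)

allFin⁺ : ∀ {n} (p : Fin n → Bool) → (∀ i → T (p i)) → T (all p (allFin n))
allFin⁺ {n} p = all⁺ p (allFin n)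

any⁻ : ∀ {A : Set} (p : A → Bool) xs → T (any p xs) → ∃ λ x → T (p x)
any⁻ p (y ∷ xs) h with T-∨-elim {p y} h
... | inj₁ q = y , q
... | inj₂ q = any⁻ p xs q

any⁺ : ∀ {A : Set} (p : A → Bool) {xs x} → x ∈ xs → T (p x) → T (any p xs)
any⁺ p {y ∷ _} (here refl) q = T-∨-inl {p y} q
any⁺ p {y ∷ _} (there m)   q = T-∨-inr {p y} (any⁺ p m q)

count-none : ∀ {n} (P : VSet n → Bool) → (∀ S → ¬ T (P S)) → countSubsets P ≡ 0
count-none {zero} P h with P [] | h []
... | true  | q = ⊥-elim (q tt)
... | false | _ = refl
count-none {suc n} P h =
  cong₂ _+_ (count-none (λ S → P (true ∷ S)) (λ S → h _)) (count-none (λ S → P (false ∷ S)) (λ S → h _))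

count-mono : ∀ {n} (P Q : VSet n → Bool) → (∀ S → T (P S) → T (Q S)) → countSubsets P ≤ countSubsets Q
count-mono {zero} P Q h with P [] | Q [] | h []
... | false | _     | _ = z≤n
... | true  | true  | _ = ≤-refl
... | true  | false | q = ⊥-elim (q tt)
count-mono {suc n} P Q h =
  +-mono-≤ (count-mono (λ S → P (true ∷ S)) (λ S → Q (true ∷ S)) (λ S → h _))
           (count-mono (λ S → P (false ∷ S)) (λ S → Q (false ∷ S)) (λ S → h _))

count-∪ : ∀ {n} (P Q R : VSet n → Bool) → (∀ S → T (P S) → T (Q S) ⊎ T (R S)) →
          countSubsets P ≤ countSubsets Q + countSubsets R
count-∪ {zero} P Q R h with P [] | Q [] | R [] | h []
... | false | _     | _     | _ = z≤n
... | true  | true  | _     | _ = s≤s z≤n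
... | true  | false | true  | _ = s≤s z≤n
... | true  | false | false | q with q tt
...   | inj₁ ()
...   | inj₂ ()
count-∪ {suc n} P Q R h = begin
    countSubsets P₁ + countSubsets P₀
  ≤⟨ +-mono-≤ (count-∪ P₁ Q₁ R₁ (λ S → h _)) (count-∪ P₀ Q₀ R₀ (λ S → h _)) ⟩
    (countSubsets Q₁ + countSubsets R₁) + (countSubsets Q₀ + countSubsets R₀)
  ≡⟨ +-interchange (countSubsets Q₁) _ _ _ ⟩
    (countSubsets Q₁ + countSubsets Q₀) + (countSubsets R₁ + countSubsets R₀) ∎
  where
  open ≤-Reasoning
  P₁ = λ S → P (true ∷ S) ; Q₁ = λ S → Q (true ∷ S) ; R₁ = λ S → R (true ∷ S)
  P₀ = λ S → P (false ∷ S) ; Q₀ = λ S → Q (false ∷ S) ; R₀ = λ S → R (false ∷ S)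
  +-interchange : ∀ a b c d → (a + b) + (c + d) ≡ (a + c) + (b + d)
  +-interchange = solve-∀

count-∪₃ : ∀ {n} (P Q₁ Q₂ Q₃ : VSet n → Bool) → (∀ S → T (P S) → T (Q₁ S) ⊎ T (Q₂ S) ⊎ T (Q₃ S)) →
           countSubsets P ≤ countSubsets Q₁ + countSubsets Q₂ + countSubsets Q₃
count-∪₃ P Q₁ Q₂ Q₃ h = begin
    countSubsets P
  ≤⟨ count-∪ P Q₁ Q₂₃ (λ S p → regroup (h S p)) ⟩
    countSubsets Q₁ + countSubsets Q₂₃
  ≤⟨ +-monoʳ-≤ (countSubsets Q₁) (count-∪ Q₂₃ Q₂ Q₃ (λ S p → T-∨-elim {Q₂ S} p)) ⟩
    countSubsets Q₁ + (countSubsets Q₂ + countSubsets Q₃)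
  ≡⟨ +-assoc (countSubsets Q₁) _ _ ⟨
    countSubsets Q₁ + countSubsets Q₂ + countSubsets Q₃ ∎
  where
  open ≤-Reasoning
  Q₂₃ : _ → Bool
  Q₂₃ S = Q₂ S ∨ Q₃ S
  regroup : ∀ {S} → T (Q₁ S) ⊎ T (Q₂ S) ⊎ T (Q₃ S) → T (Q₁ S) ⊎ T (Q₂₃ S)
  regroup (inj₁ q)        = inj₁ q
  regroup {S} (inj₂ (inj₁ q)) = inj₂ (T-∨-inl {Q₂ S} q)
  regroup {S} (inj₂ (inj₂ q)) = inj₂ (T-∨-inr {Q₂ S} q)

-- If every P-set contains u and deleting u from it gives a Q-set, then #P ≤ #Q
-- (deletion of u is injective on sets containing u).
count-delete : ∀ {n} (u : Fin n) (P Q : VSet n → Bool) →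
               (∀ S → T (P S) → T (lookup S u) × T (Q (S [ u ]≔ false))) →
               countSubsets P ≤ countSubsets Q
count-delete {suc n} zero P Q h
  rewrite count-none (λ S → P (false ∷ S)) (λ S p → proj₁ (h _ p))
        | +-identityʳ (countSubsets (λ S → P (true ∷ S))) =
  ≤-trans (count-mono (λ S → P (true ∷ S)) (λ S → Q (false ∷ S)) (λ S p → proj₂ (h _ p)))
          (m≤n+m _ _)
count-delete {suc n} (suc u) P Q h =
  +-mono-≤ (count-delete u (λ S → P (true ∷ S)) (λ S → Q (true ∷ S)) (λ S → h _))
           (count-delete u (λ S → P (false ∷ S)) (λ S → Q (false ∷ S)) (λ S → h _))

count-≤1 : ∀ {n} (P : VSet n → Bool) → (∀ S → T (P S) → ∀ i → ¬ T (lookup S i)) → countSubsets P ≤ 1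
count-≤1 {zero} P h with P []
... | true  = ≤-refl
... | false = z≤n
count-≤1 {suc n} P h rewrite count-none (λ S → P (true ∷ S)) (λ S p → h _ p zero tt) =
  count-≤1 (λ S → P (false ∷ S)) (λ S p i → h _ p (suc i))

sumFin : ∀ {n} → (Fin n → ℕ) → ℕ
sumFin {zero}  g = 0
sumFin {suc n} g = g zero + sumFin (λ i → g (suc i))

indicator : Bool → ℕ
indicator true  = 1
indicator false = 0

card : ∀ {n} → (Fin n → Bool) → ℕ
card {zero}  f = 0
card {suc n} f = indicator (f zero) + card (λ i → f (suc i))

sumFin-mono : ∀ {n} (g h : Fin n → ℕ) → (∀ i → g i ≤ h i) → sumFin g ≤ sumFin h
sumFin-mono {zero}  g h le = z≤n
sumFin-mono {suc n} g h le = +-mono-≤ (le zero) (sumFin-mono _ _ (λ i → le (suc i)))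

sumFin-*ʳ : ∀ {n} (g : Fin n → ℕ) c → sumFin g * c ≡ sumFin (λ i → g i * c)
sumFin-*ʳ {zero}  g c = refl
sumFin-*ʳ {suc n} g c =
  trans (*-distribʳ-+ c (g zero) _) (cong (g zero * c +_) (sumFin-*ʳ (λ i → g (suc i)) c))

sumFin-if : ∀ {n} (f : Fin n → Bool) c → sumFin (λ i → if f i then c else 0) ≡ card f * c
sumFin-if {zero}  f c = refl
sumFin-if {suc n} f c with f zero
... | true  = cong (c +_) (sumFin-if (λ i → f (suc i)) c)
... | false = sumFin-if (λ i → f (suc i)) c

count-⋃ : ∀ {n m} (P : VSet n → Bool) (Q : Fin m → VSet n → Bool) →
          (∀ S → T (P S) → ∃ λ u → T (Q u S)) →
          countSubsets P ≤ sumFin (λ u → countSubsets (Q u))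
count-⋃ {n} {zero} P Q h = ≤-reflexive (count-none P (λ S p → noFin (proj₁ (h S p))))
  where noFin : Fin zero → ⊥
        noFin ()
count-⋃ {n} {suc m} P Q h =
  ≤-trans (count-∪ P (Q zero) P′ split)
          (+-monoʳ-≤ (countSubsets (Q zero)) (count-⋃ P′ (λ u → Q (suc u)) rest))
  where
  P′ : VSet n → Bool
  P′ S = P S ∧ not (Q zero S)
  split : ∀ S → T (P S) → T (Q zero S) ⊎ T (P′ S)
  split S p with T? (Q zero S)
  ... | yes q = inj₁ q
  ... | no  q = inj₂ (T-∧-intro p (T-not-intro q))
  rest : ∀ S → T (P′ S) → ∃ λ u → T (Q (suc u) S)
  rest S p with h S (T-∧-fst {P S} p)
  ... | zero  , q = ⊥-elim (T-not-elim (T-∧-snd {P S} p) q)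
  ... | suc u , q = u , q

card-ext : ∀ {n} (f g : Fin n → Bool) → (∀ i → f i ≡ g i) → card f ≡ card g
card-ext {zero}  f g e = refl
card-ext {suc n} f g e = cong₂ _+_ (cong indicator (e zero)) (card-ext _ _ (λ i → e (suc i)))

card-split : ∀ {n} (f g : Fin n → Bool) → card f ≡ card (λ i → f i ∧ g i) + card (λ i → f i ∧ not (g i))
card-split {zero}  f g = refl
card-split {suc n} f g rewrite card-split (λ i → f (suc i)) (λ i → g (suc i)) with f zero | g zero
... | false | _     = refl
... | true  | true  = refl
... | true  | false = sym (+-suc _ _)

card-none : ∀ {n} (f : Fin n → Bool) → (∀ i → ¬ T (f i)) → card f ≡ 0
card-none {zero}  f h = refl
card-none {suc n} f h with f zero | h zero
... | true  | q = ⊥-elim (q tt)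
... | false | _ = card-none _ (λ i → h (suc i))

card-zero⁻ : ∀ {n} (f : Fin n → Bool) → card f ≡ 0 → ∀ i → ¬ T (f i)
card-zero⁻ {suc n} f e i p with f zero in eq
card-zero⁻ {suc n} f () i p       | true
card-zero⁻ {suc n} f e zero p     | false = subst T eq p
card-zero⁻ {suc n} f e (suc i) p  | false = card-zero⁻ (λ i → f (suc i)) e i p

card-nonzero : ∀ {n} (f : Fin n → Bool) → card f ≢ 0 → ∃ λ i → T (f i)
card-nonzero {zero}  f h = ⊥-elim (h refl)
card-nonzero {suc n} f h with T? (f zero)
... | yes p = zero , p
... | no  p with card-nonzero (λ i → f (suc i)) (λ e → h (trans (cong (λ b → indicator b + card (λ i → f (suc i))) (T-≡-false p)) e))
...   | i , q = suc i , q

card-single : ∀ {n} (f : Fin n → Bool) u → T (f u) → (∀ i → T (f i) → i ≡ u) → card f ≡ 1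
card-single {suc n} f zero p h with f zero
... | true = cong suc (card-none _ (λ i q → zero≢suc (h (suc i) q)))
  where zero≢suc : ∀ {i : Fin n} → suc i ≢ zero
        zero≢suc ()
card-single {suc n} f (suc u) p h with T? (f zero)
... | yes q with h zero q
...   | ()
card-single {suc n} f (suc u) p h | no q rewrite T-≡-false q =
  card-single (λ i → f (suc i)) u p (λ i r → Fin-suc-injective (h (suc i) r))

card-remove : ∀ {n} (f : Fin n → Bool) x k → T (f x) → card f ≡ suc k → card (λ i → f i ∧ not (i == x)) ≡ k
card-remove f x k fx e = suc-injective (begin
    1 + card (λ i → f i ∧ not (i == x))
  ≡⟨ cong (_+ card (λ i → f i ∧ not (i == x))) singleton ⟨
    card (λ i → f i ∧ (i == x)) + card (λ i → f i ∧ not (i == x))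
  ≡⟨ card-split f (_== x) ⟨
    card f
  ≡⟨ e ⟩
    suc k ∎)
  where
  open ≡-Reasoning
  singleton : card (λ i → f i ∧ (i == x)) ≡ 1
  singleton = card-single _ x (T-∧-intro fx (==-refl x)) (λ i p → ==-sound (T-∧-snd {f i} p))

card-two : ∀ {n} (f : Fin n → Bool) x → T (f x) → card f ≡ 2 →
           ∃ λ z → T (f z) × z ≢ x × (∀ w → T (f w) → w ≡ x ⊎ w ≡ z)
card-two {n} f x fx e with card-nonzero f∖x (λ c → 1≢0 (trans (sym (card-remove f x 1 fx e)) c))
  where f∖x : Fin n → Bool
        f∖x i = f i ∧ not (i == x)
        1≢0 : 1 ≢ 0
        1≢0 ()
... | z , f∖x-z = z , T-∧-fst {f z} f∖x-z , z≢x , only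
  where
  f∖x : Fin n → Bool
  f∖x i = f i ∧ not (i == x)
  z≢x : z ≢ x
  z≢x refl = T-not-elim (T-∧-snd {f z} f∖x-z) (==-refl z)
  nothing-else : card (λ i → f∖x i ∧ not (i == z)) ≡ 0
  nothing-else = card-remove f∖x z 0 f∖x-z (card-remove f x 1 fx e)
  only : ∀ w → T (f w) → w ≡ x ⊎ w ≡ z
  only w fw with w ≟ᶠ x | w ≟ᶠ z
  ... | yes p | _     = inj₁ p
  ... | no  _ | yes p = inj₂ p
  ... | no wx | no wz = ⊥-elim (card-zero⁻ _ nothing-else w
          (T-∧-intro (T-∧-intro fw (T-not-intro (wx ∘ ==-sound))) (T-not-intro (wz ∘ ==-sound))))

argmin : ∀ {n} (f : Fin n → Bool) (g : Fin n → ℕ) →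
         (∀ i → ¬ T (f i)) ⊎ ∃ λ v → T (f v) × (∀ w → T (f w) → g v ≤ g w)
argmin {zero}  f g = inj₁ (λ ())
argmin {suc n} f g with argmin (λ i → f (suc i)) (λ i → g (suc i)) | T? (f zero)
... | inj₁ none | no q = inj₁ (λ { zero p → q p ; (suc i) p → none i p })
... | inj₁ none | yes q = inj₂ (zero , q , λ { zero _ → ≤-refl ; (suc i) p → ⊥-elim (none i p) })
... | inj₂ (v , fv , min) | no q = inj₂ (suc v , fv , λ { zero p → ⊥-elim (q p) ; (suc i) p → min i p })
... | inj₂ (v , fv , min) | yes q with g zero ≤? g (suc v)
...   | yes le = inj₂ (zero , q , λ { zero _ → ≤-refl ; (suc i) p → ≤-trans le (min i p) })
...   | no nle = inj₂ (suc v , fv , λ { zero p → <⇒≤ (≰⇒> nle) ; (suc i) p → min i p })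

infix 4 _∋_
_∋_ : ∀ {n} → VSet n → Fin n → Set
U ∋ i = T (lookup U i)

size : ∀ {n} → VSet n → ℕ
size U = card (lookup U)

size-⊆ : ∀ {n} (U W : VSet n) → (∀ i → W ∋ i → U ∋ i) →
         size U ≡ size W + card (λ i → lookup U i ∧ not (lookup W i))
size-⊆ U W W⊆U = trans (card-split (lookup U) (lookup W))
                       (cong (_+ card (λ i → lookup U i ∧ not (lookup W i))) (card-ext _ _ U∩W≡W))
  where
  ∧-absorb : ∀ a b → (T b → T a) → (a ∧ b) ≡ b
  ∧-absorb true  b     _ = refl
  ∧-absorb false true  h = ⊥-elim (h tt)
  ∧-absorb false false _ = refl
  U∩W≡W : ∀ i → (lookup U i ∧ lookup W i) ≡ lookup W i
  U∩W≡W i = ∧-absorb (lookup U i) (lookup W i) (W⊆U i)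

size-zero⁻ : ∀ {n} (U : VSet n) → size U ≡ 0 → ∀ i → ¬ U ∋ i
size-zero⁻ U = card-zero⁻ (lookup U)

delete-elim : ∀ {n} (S : VSet n) u i → (S [ u ]≔ false) ∋ i → i ≢ u × S ∋ i
delete-elim S u i p with i ≟ᶠ u
... | yes refl = ⊥-elim (T-cast (lookup∘update i S false) p)
... | no  i≢u  = i≢u , T-cast (lookup∘update′ i≢u S false) p

insert-elim : ∀ {n} (S : VSet n) v i → i ≢ v → (S [ v ]≔ true) ∋ i → S ∋ i
insert-elim S v i i≢v p = T-cast (lookup∘update′ i≢v S true) p

delete-intro : ∀ {n} (S : VSet n) u i → i ≢ u → S ∋ i → (S [ u ]≔ false) ∋ i
delete-intro S u i i≢u p = T-cast (sym (lookup∘update′ i≢u S false)) p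

module InducedMIS {n : ℕ} (G : Graph n) where

  _~_ : Fin n → Fin n → Set
  i ~ j = T (adj G i j)

  ~-sym : ∀ {i j} → i ~ j → j ~ i
  ~-sym {i} {j} = T-cast (Graph.sym G i j)

  ~-irrefl : ∀ i → ¬ i ~ i
  ~-irrefl i = T-cast (irrefl G i)

  ~-distinct : ∀ {i j} → i ~ j → i ≢ j
  ~-distinct {i} p refl = ~-irrefl i p

  record IsMisIn (U S : VSet n) : Set where
    field
      sub : ∀ i → S ∋ i → U ∋ i
      ind : ∀ i j → S ∋ i → S ∋ j → ¬ i ~ j
      dom : ∀ v → U ∋ v → ¬ S ∋ v → ∃ λ w → S ∋ w × v ~ w
  open IsMisIn public

  -- The same notion as a Boolean predicate, so that it can be counted.
  isSubset : VSet n → VSet n → Bool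
  isSubset U S = all (λ i → not (lookup S i) ∨ lookup U i) (allFin n)

  isDominating : VSet n → VSet n → Bool
  isDominating U S = all (λ v → not (lookup U v) ∨ (lookup S v ∨ any (λ w → lookup S w ∧ adj G v w) (allFin n))) (allFin n)

  isMisIn : VSet n → VSet n → Bool
  isMisIn U S = isSubset U S ∧ (isIndependent G S ∧ isDominating U S)

  misIn : VSet n → ℕ
  misIn U = countSubsets (isMisIn U)

  independent⁻ : ∀ S → T (isIndependent G S) → ∀ i j → S ∋ i → S ∋ j → ¬ i ~ j
  independent⁻ S h i j si sj i~j =
    T-not-elim (allFin⁻ _ (allFin⁻ _ h i) j) (T-∧-intro si (T-∧-intro sj i~j))

  independent⁺ : ∀ S → (∀ i j → S ∋ i → S ∋ j → ¬ i ~ j) → T (isIndependent G S)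
  independent⁺ S h = allFin⁺ _ λ i → allFin⁺ _ λ j → T-not-intro λ q →
    h i j (T-∧-fst {lookup S i} q) (T-∧-fst {lookup S j} (T-∧-snd {lookup S i} q))
          (T-∧-snd {lookup S j} (T-∧-snd {lookup S i} q))

  isMisIn-sound : ∀ U S → T (isMisIn U S) → IsMisIn U S
  isMisIn-sound U S h = record
    { sub = S⊆U ; ind = independent⁻ S (T-∧-fst {isIndependent G S} rest) ; dom = dominating }
    where
    rest = T-∧-snd {isSubset U S} h
    S⊆U : ∀ i → S ∋ i → U ∋ i
    S⊆U i i∈S with T-∨-elim {not (lookup S i)} (allFin⁻ _ (T-∧-fst {isSubset U S} h) i)
    ... | inj₁ q = ⊥-elim (T-not-elim q i∈S)
    ... | inj₂ q = q
    dominating : ∀ v → U ∋ v → ¬ S ∋ v → ∃ λ w → S ∋ w × v ~ w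
    dominating v v∈U v∉S with T-∨-elim {not (lookup U v)} (allFin⁻ _ (T-∧-snd {isIndependent G S} rest) v)
    ... | inj₁ q = ⊥-elim (T-not-elim q v∈U)
    ... | inj₂ q with T-∨-elim {lookup S v} q
    ...   | inj₁ v∈S = ⊥-elim (v∉S v∈S)
    ...   | inj₂ r with any⁻ _ (allFin n) r
    ...     | w , p = w , T-∧-fst {lookup S w} p , T-∧-snd {lookup S w} p

  isMisIn-complete : ∀ U S → IsMisIn U S → T (isMisIn U S)
  isMisIn-complete U S m = T-∧-intro (allFin⁺ _ S⊆U) (T-∧-intro (independent⁺ S (ind m)) (allFin⁺ _ dominating))
    where
    S⊆U : ∀ i → T (not (lookup S i) ∨ lookup U i)
    S⊆U i with T? (lookup S i)
    ... | yes p = T-∨-inr {not (lookup S i)} (sub m i p)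
    ... | no  p = T-∨-inl (T-not-intro p)
    dominating : ∀ v → T (not (lookup U v) ∨ (lookup S v ∨ any (λ w → lookup S w ∧ adj G v w) (allFin n)))
    dominating v with T? (lookup U v) | T? (lookup S v)
    ... | no  p | _     = T-∨-inl (T-not-intro p)
    ... | yes _ | yes q = T-∨-inr {not (lookup U v)} (T-∨-inl q)
    ... | yes p | no  q with dom m v p q
    ...   | w , sw , v~w = T-∨-inr {not (lookup U v)} (T-∨-inr {lookup S v}
                             (any⁺ _ (∈-allFin w) (T-∧-intro sw v~w)))

  misIn-≤ : ∀ U W → (∀ i → U ∋ i → W ∋ i) → (∀ i → W ∋ i → U ∋ i) → misIn U ≤ misIn W
  misIn-≤ U W U⊆W W⊆U = count-mono _ _ λ S m → isMisIn-complete W S (transfer (isMisIn-sound U S m))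
    where
    transfer : ∀ {S} → IsMisIn U S → IsMisIn W S
    transfer m = record { sub = λ i p → U⊆W i (sub m i p) ; ind = ind m ; dom = λ v p q → dom m v (W⊆U v p) q }

  misIn-empty : ∀ U → size U ≡ 0 → misIn U ≤ 1
  misIn-empty U e = count-≤1 (isMisIn U) (λ S p i si → size-zero⁻ U e i (sub (isMisIn-sound U S p) i si))

  full : VSet n
  full = replicate n true

  size-full : size full ≡ n
  size-full = trans (card-ext (lookup full) (λ _ → true) (λ i → lookup-replicate i true)) (card-true n)
    where card-true : ∀ m → card {m} (λ _ → true) ≡ m
          card-true zero    = refl
          card-true (suc m) = cong suc (card-true m)

  dependent⁻ : ∀ S → ¬ T (isIndependent G S) → ∃ λ i → ∃ λ j → S ∋ i × S ∋ j × i ~ j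
  dependent⁻ S h with all-counterexample _ (allFin n) h
  ... | i , qi with all-counterexample (λ j → not (lookup S i ∧ (lookup S j ∧ adj G i j))) (allFin n) qi
  ...   | j , qj = i , j , T-∧-fst {lookup S i} edge , T-∧-fst {lookup S j} (T-∧-snd {lookup S i} edge) ,
                   T-∧-snd {lookup S j} (T-∧-snd {lookup S i} edge)
    where edge = T-not-not qj

  insertion-edge : ∀ S v → T (isIndependent G S) → ¬ T (isIndependent G (S [ v ]≔ true)) → ∃ λ w → S ∋ w × v ~ w
  insertion-edge S v indep dep with dependent⁻ (S [ v ]≔ true) dep
  ... | i , j , i∈S′ , j∈S′ , i~j with i ≟ᶠ v | j ≟ᶠ v
  ...   | yes refl | yes refl = ⊥-elim (~-irrefl i i~j)
  ...   | yes refl | no  j≢v  = j , insert-elim S v j j≢v j∈S′ , i~j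
  ...   | no  i≢v  | yes refl = i , insert-elim S v i i≢v i∈S′ , ~-sym i~j
  ...   | no  i≢v  | no  j≢v  =
    ⊥-elim (independent⁻ S indep i j (insert-elim S v i i≢v i∈S′) (insert-elim S v j j≢v j∈S′) i~j)

  mis≤misIn-full : mis G ≤ misIn full
  mis≤misIn-full = count-mono (isMIS G) (isMisIn full) λ S h → isMisIn-complete full S (fromMIS S h)
    where
    fromMIS : ∀ S → T (isMIS G S) → IsMisIn full S
    fromMIS S h = record { sub = λ i _ → T-cast (sym (lookup-replicate i true)) tt ; ind = independent⁻ S indep ; dom = dominating }
      where
      indep = T-∧-fst {isIndependent G S} h
      maximal = T-∧-snd {isIndependent G S} h
      dominating : ∀ v → full ∋ v → ¬ S ∋ v → ∃ λ w → S ∋ w × v ~ w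
      dominating v _ v∉S with T-∨-elim {lookup S v} (allFin⁻ _ maximal v)
      ... | inj₁ v∈S = ⊥-elim (v∉S v∈S)
      ... | inj₂ q = insertion-edge S v indep (T-not-elim q)

  infixl 6 _∖N[_]
  _∖N[_] : VSet n → Fin n → VSet n
  U ∖N[ u ] = tabulate (λ i → lookup U i ∧ (not (i == u) ∧ not (adj G u i)))

  ∖N-lookup : ∀ U u i → lookup (U ∖N[ u ]) i ≡ (lookup U i ∧ (not (i == u) ∧ not (adj G u i)))
  ∖N-lookup U u i = lookup∘tabulate _ i

  ∖N-elim : ∀ U u i → U ∖N[ u ] ∋ i → U ∋ i × i ≢ u × ¬ u ~ i
  ∖N-elim U u i p = T-∧-fst {lookup U i} q , (λ { refl → T-not-elim i≠u (==-refl i) }) , T-not-elim u≁i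
    where
    q = T-cast (∖N-lookup U u i) p
    i≠u = T-∧-fst {not (i == u)} (T-∧-snd {lookup U i} q)
    u≁i = T-∧-snd {not (i == u)} (T-∧-snd {lookup U i} q)

  ∖N-intro : ∀ U u i → U ∋ i → i ≢ u → ¬ u ~ i → U ∖N[ u ] ∋ i
  ∖N-intro U u i p i≢u u≁i =
    T-cast (sym (∖N-lookup U u i)) (T-∧-intro p (T-∧-intro (T-not-intro (i≢u ∘ ==-sound)) (T-not-intro u≁i)))

  ∖N-⊆ : ∀ U u i → U ∖N[ u ] ∋ i → U ∋ i
  ∖N-⊆ U u i p = proj₁ (∖N-elim U u i p)

  deg : VSet n → Fin n → ℕ
  deg U u = card (λ w → lookup U w ∧ adj G u w)

  size-∖N : ∀ U u → U ∋ u → size (U ∖N[ u ]) + suc (deg U u) ≡ size U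
  size-∖N U u u∈U = sym (begin
      size U
    ≡⟨ card-split (lookup U) (_== u) ⟩
      card (λ i → lookup U i ∧ (i == u)) + card (λ i → lookup U i ∧ not (i == u))
    ≡⟨ cong₂ _+_ (card-single _ u (T-∧-intro u∈U (==-refl u)) (λ i p → ==-sound (T-∧-snd {lookup U i} p)))
                 (card-split (λ i → lookup U i ∧ not (i == u)) (adj G u)) ⟩
      1 + (card (λ i → (lookup U i ∧ not (i == u)) ∧ adj G u i)
           + card (λ i → (lookup U i ∧ not (i == u)) ∧ not (adj G u i)))
    ≡⟨ cong suc (cong₂ _+_ (card-ext _ _ neighbours) (card-ext _ _ rest)) ⟩
      1 + (deg U u + size (U ∖N[ u ]))
    ≡⟨ cong suc (+-comm (deg U u) _) ⟩
      suc (size (U ∖N[ u ]) + deg U u)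
    ≡⟨ +-suc _ _ ⟨
      size (U ∖N[ u ]) + suc (deg U u) ∎)
    where
    open ≡-Reasoning
    -- u itself is not a neighbour of u, so excluding it does not change N(u).
    neighbours : ∀ i → ((lookup U i ∧ not (i == u)) ∧ adj G u i) ≡ (lookup U i ∧ adj G u i)
    neighbours i with i ≟ᶠ u
    ... | yes refl rewrite irrefl G i = trans (∧-zeroʳ _) (sym (∧-zeroʳ _))
    ... | no  _    = cong (_∧ adj G u i) (∧-identityʳ (lookup U i))
    rest : ∀ i → ((lookup U i ∧ not (i == u)) ∧ not (adj G u i)) ≡ lookup (U ∖N[ u ]) i
    rest i = trans (∧-assoc (lookup U i) _ _) (sym (∖N-lookup U u i))

  size-∖N-≤ : ∀ U u r → U ∋ u → r ≤ deg U u → size (U ∖N[ u ]) + suc r ≤ size U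
  size-∖N-≤ U u r u∈U r≤d = ≤-trans (+-monoʳ-≤ (size (U ∖N[ u ])) (s≤s r≤d)) (≤-reflexive (size-∖N U u u∈U))

  misIn-delete : ∀ U S u → IsMisIn U S → S ∋ u → IsMisIn (U ∖N[ u ]) (S [ u ]≔ false)
  misIn-delete U S u m u∈S = record { sub = S′⊆U′ ; ind = independent ; dom = dominating }
    where
    S′⊆U′ : ∀ i → (S [ u ]≔ false) ∋ i → U ∖N[ u ] ∋ i
    S′⊆U′ i p with delete-elim S u i p
    ... | i≢u , i∈S = ∖N-intro U u i (sub m i i∈S) i≢u (ind m u i u∈S i∈S)
    independent : ∀ i j → (S [ u ]≔ false) ∋ i → (S [ u ]≔ false) ∋ j → ¬ i ~ j
    independent i j p q = ind m i j (proj₂ (delete-elim S u i p)) (proj₂ (delete-elim S u j q))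
    dominating : ∀ v → U ∖N[ u ] ∋ v → ¬ (S [ u ]≔ false) ∋ v → ∃ λ w → (S [ u ]≔ false) ∋ w × v ~ w
    dominating v p v∉S′ with ∖N-elim U u v p
    ... | v∈U , v≢u , u≁v with dom m v v∈U (v∉S′ ∘ delete-intro S u v v≢u)
    ...   | w , w∈S , v~w = w , delete-intro S u w (λ { refl → u≁v (~-sym v~w) }) w∈S , v~w

  count-containing : ∀ U u (R : VSet n → Bool) → (∀ S → T (R S) → IsMisIn U S × S ∋ u) →
                     countSubsets R ≤ misIn (U ∖N[ u ])
  count-containing U u R h = count-delete u R (isMisIn (U ∖N[ u ])) λ S r →
    proj₂ (h S r) , isMisIn-complete _ _ (misIn-delete U S u (proj₁ (h S r)) (proj₂ (h S r)))

  ItmIn : VSet n → ℕ → Set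
  ItmIn U k = Σ (InducedTriangleMatching G k) λ M → ∀ a i → U ∋ InducedTriangleMatching.tri M a i

  ItmBound : VSet n → ℕ → Set
  ItmBound U t = ∀ k → ItmIn U k → k ≤ t

  itmBound-⊆ : ∀ U W t → (∀ i → W ∋ i → U ∋ i) → ItmBound U t → ItmBound W t
  itmBound-⊆ U W t W⊆U b k (M , inW) = b k (M , λ a i → W⊆U _ (inW a i))

  itmBound-full : ∀ t → IsItm G t → ItmBound full t
  itmBound-full t (_ , maximum) k (M , _) = maximum k M

  module TriangleComponent (U : VSet n) (v x y : Fin n) (v∈U : U ∋ v) (x∈U : U ∋ x) (y∈U : U ∋ y)
           (v~x : v ~ x) (v~y : v ~ y) (x~y : x ~ y)
           (N-x : ∀ w → U ∋ w → x ~ w → w ≡ v ⊎ w ≡ y)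
           (N-y : ∀ w → U ∋ w → y ~ w → w ≡ v ⊎ w ≡ x) where

    τ : Fin 3 → Fin n
    τ zero             = v
    τ (suc zero)       = x
    τ (suc (suc zero)) = y

    τ-∈U : ∀ i → U ∋ τ i
    τ-∈U zero             = v∈U
    τ-∈U (suc zero)       = x∈U
    τ-∈U (suc (suc zero)) = y∈U

    τ-adj : ∀ i j → i ≢ j → τ i ~ τ j
    τ-adj zero             zero             ne = ⊥-elim (ne refl)
    τ-adj zero             (suc zero)       _  = v~x
    τ-adj zero             (suc (suc zero)) _  = v~y
    τ-adj (suc zero)       zero             _  = ~-sym v~x
    τ-adj (suc zero)       (suc zero)       ne = ⊥-elim (ne refl)
    τ-adj (suc zero)       (suc (suc zero)) _  = x~y
    τ-adj (suc (suc zero)) zero             _  = ~-sym v~y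
    τ-adj (suc (suc zero)) (suc zero)       _  = ~-sym x~y
    τ-adj (suc (suc zero)) (suc (suc zero)) ne = ⊥-elim (ne refl)

    τ-injective : ∀ i j → τ i ≡ τ j → i ≡ j
    τ-injective i j e with i ≟ᶠ j
    ... | yes i≡j = i≡j
    ... | no  i≢j = ⊥-elim (~-distinct (τ-adj i j i≢j) e)

    τ-∉ : ∀ i → ¬ U ∖N[ v ] ∋ τ i
    τ-∉ zero             p = proj₁ (proj₂ (∖N-elim U v v p)) refl
    τ-∉ (suc zero)       p = proj₂ (proj₂ (∖N-elim U v x p)) v~x
    τ-∉ (suc (suc zero)) p = proj₂ (proj₂ (∖N-elim U v y p)) v~y

    τ-isolated : ∀ i w → U ∖N[ v ] ∋ w → ¬ τ i ~ w
    τ-isolated zero w p v~w = proj₂ (proj₂ (∖N-elim U v w p)) v~w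
    τ-isolated (suc zero) w p x~w with N-x w (∖N-⊆ U v w p) x~w
    ... | inj₁ refl = proj₁ (proj₂ (∖N-elim U v w p)) refl
    ... | inj₂ refl = proj₂ (proj₂ (∖N-elim U v w p)) v~y
    τ-isolated (suc (suc zero)) w p y~w with N-y w (∖N-⊆ U v w p) y~w
    ... | inj₁ refl = proj₁ (proj₂ (∖N-elim U v w p)) refl
    ... | inj₂ refl = proj₂ (proj₂ (∖N-elim U v w p)) v~x

    extend : ∀ k → ItmIn (U ∖N[ v ]) k → ItmIn U (suc k)
    extend k (M , inW) = record { tri = tri ; distinct = distinct ; inside = inside ; between = between } , inU
      where
      module M = InducedTriangleMatching M
      tri : Fin (suc k) → Fin 3 → Fin n
      tri zero    = τ
      tri (suc a) = M.tri a
      distinct : ∀ a i b j → tri a i ≡ tri b j → a ≡ b × i ≡ j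
      distinct zero    i zero    j e = refl , τ-injective i j e
      distinct zero    i (suc b) j e = ⊥-elim (τ-∉ i (subst (U ∖N[ v ] ∋_) (sym e) (inW b j)))
      distinct (suc a) i zero    j e = ⊥-elim (τ-∉ j (subst (U ∖N[ v ] ∋_) e (inW a i)))
      distinct (suc a) i (suc b) j e with M.distinct a i b j e
      ... | refl , i≡j = refl , i≡j
      inside : ∀ a i j → i ≢ j → adj G (tri a i) (tri a j) ≡ true
      inside zero    i j ne = T-≡-true (τ-adj i j ne)
      inside (suc a) i j ne = M.inside a i j ne
      between : ∀ a b i j → a ≢ b → adj G (tri a i) (tri b j) ≡ false
      between zero    zero    i j ne = ⊥-elim (ne refl)
      between zero    (suc b) i j ne = T-≡-false (τ-isolated i (M.tri b j) (inW b j))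
      between (suc a) zero    i j ne = T-≡-false (τ-isolated j (M.tri a i) (inW a i) ∘ ~-sym)
      between (suc a) (suc b) i j ne = M.between a b i j (ne ∘ cong suc)
      inU : ∀ a i → U ∋ tri a i
      inU zero    i = τ-∈U i
      inU (suc a) i = ∖N-⊆ U v _ (inW a i)

    emptyMatching : InducedTriangleMatching G 0
    emptyMatching = record { tri = λ () ; distinct = λ () ; inside = λ () ; between = λ () }

    itmBound-∖N : ∀ t → ItmBound U t → ∃ λ t′ → t ≡ suc t′ × ItmBound (U ∖N[ v ]) t′
    itmBound-∖N t b with b 1 (extend 0 (emptyMatching , λ ()))
    ... | s≤s {n = t′} _ = t′ , refl , λ k m → ≤-pred (b (suc k) (extend k m))

  count-containing₂ : ∀ U y z (R : VSet n → Bool) → z ≢ y → (∀ S → T (R S) → IsMisIn U S × S ∋ y × S ∋ z) →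
                      countSubsets R ≤ misIn (U ∖N[ y ] ∖N[ z ])
  count-containing₂ U y z R z≢y h = ≤-trans
    (count-delete y R containing-z λ S r → let (m , y∈S , z∈S) = h S r in
       y∈S , T-∧-intro (isMisIn-complete _ _ (misIn-delete U S y m y∈S)) (delete-intro S y z z≢y z∈S))
    (count-containing (U ∖N[ y ]) z containing-z λ S p →
       isMisIn-sound _ S (T-∧-fst {isMisIn (U ∖N[ y ]) S} p) , T-∧-snd {isMisIn (U ∖N[ y ]) S} p)
    where
    containing-z : VSet n → Bool
    containing-z S = isMisIn (U ∖N[ y ]) S ∧ lookup S z

  forced-neighbour : ∀ U S a b c → IsMisIn U S → U ∋ a → (∀ w → U ∋ w → a ~ w → w ≡ b ⊎ w ≡ c) →
                     ¬ S ∋ a → ¬ S ∋ b → S ∋ c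
  forced-neighbour U S a b c m a∈U N-a a∉S b∉S with dom m a a∈U a∉S
  ... | w , w∈S , a~w with N-a w (sub m w w∈S) a~w
  ...   | inj₁ refl = ⊥-elim (b∉S w∈S)
  ...   | inj₂ refl = w∈S

  deg-pos : ∀ U u w → U ∋ w → u ~ w → 1 ≤ deg U u
  deg-pos U u w w∈U u~w = n≢0⇒n>0 λ e → card-zero⁻ (λ i → lookup U i ∧ adj G u i) e w (T-∧-intro w∈U u~w)

  other-neighbour : ∀ U x v → U ∋ v → x ~ v → deg U x ≡ 2 →
                    ∃ λ z → U ∋ z × x ~ z × z ≢ v × (∀ w → U ∋ w → x ~ w → w ≡ v ⊎ w ≡ z)
  other-neighbour U x v v∈U x~v deg-x with card-two (λ w → lookup U w ∧ adj G x w) v (T-∧-intro v∈U x~v) deg-x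
  ... | z , Nz , z≢v , only = z , T-∧-fst {lookup U z} Nz , T-∧-snd {lookup U z} Nz , z≢v ,
                              λ w w∈U x~w → only w (T-∧-intro w∈U x~w)

  two-neighbours : ∀ U x a b → U ∋ a → U ∋ b → x ~ a → x ~ b → b ≢ a → deg U x ≡ 2 →
                   ∀ w → U ∋ w → x ~ w → w ≡ a ⊎ w ≡ b
  two-neighbours U x a b a∈U b∈U x~a x~b b≢a deg-x with other-neighbour U x a a∈U x~a deg-x
  ... | z , _ , _ , _ , only with only b b∈U x~b
  ...   | inj₁ b≡a  = ⊥-elim (b≢a b≡a)
  ...   | inj₂ refl = only

  ∖N-same : ∀ U a b → (∀ i → U ∋ i → i ≡ a ⊎ a ~ i → i ≡ b ⊎ b ~ i) → (∀ i → U ∋ i → i ≡ b ⊎ b ~ i → i ≡ a ⊎ a ~ i) →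
            misIn (U ∖N[ a ]) ≤ misIn (U ∖N[ b ])
  ∖N-same U a b Na⊆Nb Nb⊆Na = misIn-≤ (U ∖N[ a ]) (U ∖N[ b ]) (survives a b Nb⊆Na) (survives b a Na⊆Nb)
    where
    survives : ∀ a b → (∀ i → U ∋ i → i ≡ b ⊎ b ~ i → i ≡ a ⊎ a ~ i) → ∀ i → U ∖N[ a ] ∋ i → U ∖N[ b ] ∋ i
    survives a b Nb⊆Na i p with ∖N-elim U a i p
    ... | i∈U , i≢a , a≁i = ∖N-intro U b i i∈U (λ i≡b → outside (inj₁ i≡b)) (λ b~i → outside (inj₂ b~i))
      where outside : ¬ (i ≡ b ⊎ b ~ i)
            outside q with Nb⊆Na i i∈U q
            ... | inj₁ i≡a = i≢a i≡a
            ... | inj₂ a~i = a≁i a~i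

  ∖N-triangle : ∀ U a b c → a ~ b → a ~ c → b ~ c →
                (∀ w → U ∋ w → a ~ w → w ≡ b ⊎ w ≡ c) → (∀ w → U ∋ w → b ~ w → w ≡ a ⊎ w ≡ c) →
                misIn (U ∖N[ b ]) ≤ misIn (U ∖N[ a ])
  ∖N-triangle U a b c a~b a~c b~c N-a N-b = ∖N-same U b a N[b]⊆N[a] N[a]⊆N[b]
    where
    N[b]⊆N[a] : ∀ i → U ∋ i → i ≡ b ⊎ b ~ i → i ≡ a ⊎ a ~ i
    N[b]⊆N[a] i _   (inj₁ refl) = inj₂ a~b
    N[b]⊆N[a] i i∈U (inj₂ b~i) with N-b i i∈U b~i
    ... | inj₁ i≡a = inj₁ i≡a
    ... | inj₂ refl = inj₂ a~c
    N[a]⊆N[b] : ∀ i → U ∋ i → i ≡ a ⊎ a ~ i → i ≡ b ⊎ b ~ i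
    N[a]⊆N[b] i _   (inj₁ refl) = inj₂ (~-sym a~b)
    N[a]⊆N[b] i i∈U (inj₂ a~i) with N-a i i∈U a~i
    ... | inj₁ i≡b = inj₁ i≡b
    ... | inj₂ refl = inj₂ b~c

^-distrib-* : ∀ a b k → (a * b) ^ k ≡ a ^ k * b ^ k
^-distrib-* a b zero    = refl
^-distrib-* a b (suc k) = trans (cong (a * b *_) (^-distrib-* a b k)) (interchange a b (a ^ k) (b ^ k))
  where interchange : ∀ a b x y → a * b * (x * y) ≡ a * x * (b * y)
        interchange = solve-∀

-- MisBound s t x :  x ≤ 3^t (10/7)^(s − 3t),  with denominators cleared.
MisBound : ℕ → ℕ → ℕ → Set
MisBound s t x = x * 7 ^ s * 10 ^ (3 * t) ≤ 3 ^ t * 7 ^ (3 * t) * 10 ^ s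

-- Within s t r x :  x ≤ 3^t (10/7)^(s − 3t) · (7/10)^r,  the budget of a branch
-- that deletes at least r of the s vertices.
Within : ℕ → ℕ → ℕ → ℕ → Set
Within s t r x = x * 7 ^ s * 10 ^ (3 * t) * 10 ^ r ≤ 3 ^ t * 7 ^ (3 * t) * 10 ^ s * 7 ^ r

within-shrink : ∀ {s′ s t x} r → MisBound s′ t x → s′ + r ≤ s → Within s t r x
within-shrink {s′} {s} {t} {x} r h le with m≤n⇒∃[o]m+o≡n le
... | e , refl = begin
    x * 7 ^ (s′ + r + e) * A * 10 ^ r
  ≡⟨ cong (λ z → x * z * A * 10 ^ r) (^-split 7) ⟩
    x * (7 ^ s′ * 7 ^ r * 7 ^ e) * A * 10 ^ r
  ≡⟨ regroup₁ x (7 ^ s′) (7 ^ r) (7 ^ e) A (10 ^ r) ⟩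
    (x * 7 ^ s′ * A) * (7 ^ r * 7 ^ e * 10 ^ r)
  ≤⟨ *-mono-≤ h (*-monoˡ-≤ (10 ^ r) (*-monoʳ-≤ (7 ^ r) (^-monoˡ-≤ e 7≤10))) ⟩
    (C * 10 ^ s′) * (7 ^ r * 10 ^ e * 10 ^ r)
  ≡⟨ regroup₂ C (10 ^ s′) (7 ^ r) (10 ^ e) (10 ^ r) ⟩
    C * (10 ^ s′ * 10 ^ r * 10 ^ e) * 7 ^ r
  ≡⟨ cong (λ z → C * z * 7 ^ r) (^-split 10) ⟨
    C * 10 ^ (s′ + r + e) * 7 ^ r ∎
  where
  open ≤-Reasoning
  A = 10 ^ (3 * t)
  C = 3 ^ t * 7 ^ (3 * t)
  7≤10 : 7 ≤ 10
  7≤10 = ≤ᵇ⇒≤ 7 10 tt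
  ^-split : ∀ b → b ^ (s′ + r + e) ≡ b ^ s′ * b ^ r * b ^ e
  ^-split b = trans (^-distribˡ-+-* b (s′ + r) e) (cong (_* b ^ e) (^-distribˡ-+-* b s′ r))
  regroup₁ : ∀ x p q w a u → x * (p * q * w) * a * u ≡ (x * p * a) * (q * w * u)
  regroup₁ = solve-∀
  regroup₂ : ∀ c p q w u → (c * p) * (q * w * u) ≡ c * (p * u * w) * q
  regroup₂ = solve-∀

branching-factor : ∀ d → d ≢ 2 → suc d * 7 ^ suc d ≤ 10 ^ suc d
branching-factor 0 _ = ≤ᵇ⇒≤ _ _ tt
branching-factor 1 _ = ≤ᵇ⇒≤ _ _ tt
branching-factor 2 d≢2 = ⊥-elim (d≢2 refl)
branching-factor (suc (suc (suc d))) _ = from-four d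
  where
  from-four : ∀ d → (4 + d) * 7 ^ (4 + d) ≤ 10 ^ (4 + d)
  from-four zero    = ≤ᵇ⇒≤ _ _ tt
  from-four (suc d) = begin
      (5 + d) * (7 * 7 ^ (4 + d))
    ≡⟨ regroup (7 ^ (4 + d)) d ⟩
      (35 + 7 * d) * 7 ^ (4 + d)
    ≤⟨ *-monoˡ-≤ (7 ^ (4 + d)) (+-monoʳ-≤ 35 (m≤n+m (7 * d) (5 + 3 * d))) ⟩
      (35 + (5 + 3 * d + 7 * d)) * 7 ^ (4 + d)
    ≡⟨ cong (_* 7 ^ (4 + d)) (tens d) ⟩
      10 * (4 + d) * 7 ^ (4 + d)
    ≡⟨ *-assoc 10 (4 + d) (7 ^ (4 + d)) ⟩
      10 * ((4 + d) * 7 ^ (4 + d))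
    ≤⟨ *-monoʳ-≤ 10 (from-four d) ⟩
      10 * 10 ^ (4 + d) ∎
    where
    open ≤-Reasoning
    regroup : ∀ p d → (5 + d) * (7 * p) ≡ (35 + 7 * d) * p
    regroup = solve-∀
    tens : ∀ d → 35 + (5 + 3 * d + 7 * d) ≡ 10 * (4 + d)
    tens = solve-∀

combine-uniform : ∀ {m s t} (x : Fin m → ℕ) (f : Fin m → Bool) d → d ≢ 2 → card f ≡ suc d →
                  (∀ u → T (f u) → Within s t (suc d) (x u)) → (∀ u → ¬ T (f u) → x u ≡ 0) →
                  MisBound s t (sumFin x)
combine-uniform {m} {s} {t} x f d d≢2 card-f budget outside = *-cancelʳ-≤ _ _ (10 ^ r) {{m^n≢0 10 r}} (begin
    sumFin x * P * A * 10 ^ r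
  ≡⟨ distribute ⟩
    sumFin (λ u → x u * (P * A) * 10 ^ r)
  ≤⟨ sumFin-mono _ _ (λ u → per-branch u (f u) refl) ⟩
    sumFin (λ u → if f u then K * 7 ^ r else 0)
  ≡⟨ sumFin-if f (K * 7 ^ r) ⟩
    card f * (K * 7 ^ r)
  ≡⟨ trans (cong (_* (K * 7 ^ r)) card-f) (regroup r K (7 ^ r)) ⟩
    K * (r * 7 ^ r)
  ≤⟨ *-monoʳ-≤ K (branching-factor d d≢2) ⟩
    K * 10 ^ r ∎)
  where
  open ≤-Reasoning
  r = suc d
  P = 7 ^ s
  A = 10 ^ (3 * t)
  K = 3 ^ t * 7 ^ (3 * t) * 10 ^ s
  distribute : sumFin x * P * A * 10 ^ r ≡ sumFin (λ u → x u * (P * A) * 10 ^ r)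
  distribute = trans (cong (_* 10 ^ r) (trans (*-assoc (sumFin x) P A) (sumFin-*ʳ x (P * A))))
                     (sumFin-*ʳ (λ u → x u * (P * A)) (10 ^ r))
  regroup : ∀ r K p → r * (K * p) ≡ K * (r * p)
  regroup = solve-∀
  per-branch : ∀ u b → f u ≡ b → x u * (P * A) * 10 ^ r ≤ (if b then K * 7 ^ r else 0)
  per-branch u true  e = ≤-trans (≤-reflexive (cong (_* 10 ^ r) (sym (*-assoc (x u) P A))))
                                 (budget u (T-cast (sym e) tt))
  per-branch u false e rewrite outside u (T-cast e) = z≤n

-- Branching into three cases deleting at least 3, 3 and 3 + r vertices,
-- provided 2 (7/10)^3 + (7/10)^(3+r) ≤ 1.
combine₃ : ∀ {s t} r x₁ x₂ x₃ → 686 * 10 ^ r + 7 ^ (3 + r) ≤ 10 ^ (3 + r) →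
           Within s t 3 x₁ → Within s t 3 x₂ → Within s t (3 + r) x₃ → MisBound s t (x₁ + x₂ + x₃)
combine₃ {s} {t} r x₁ x₂ x₃ weights h₁ h₂ h₃ = *-cancelʳ-≤ _ _ (10 ^ (3 + r)) {{m^n≢0 10 (3 + r)}} (begin
    (x₁ + x₂ + x₃) * P * A * 10 ^ (3 + r)
  ≡⟨ expand x₁ x₂ x₃ P A (10 ^ r) ⟩
    x₁ * P * A * 10 ^ 3 * 10 ^ r + x₂ * P * A * 10 ^ 3 * 10 ^ r + x₃ * P * A * 10 ^ (3 + r)
  ≤⟨ +-mono-≤ (+-mono-≤ (*-monoˡ-≤ (10 ^ r) h₁) (*-monoˡ-≤ (10 ^ r) h₂)) h₃ ⟩
    K * 343 * 10 ^ r + K * 343 * 10 ^ r + K * 7 ^ (3 + r)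
  ≡⟨ collect K (10 ^ r) (7 ^ (3 + r)) ⟩
    K * (686 * 10 ^ r + 7 ^ (3 + r))
  ≤⟨ *-monoʳ-≤ K weights ⟩
    K * 10 ^ (3 + r) ∎)
  where
  open ≤-Reasoning
  P = 7 ^ s
  A = 10 ^ (3 * t)
  K = 3 ^ t * 7 ^ (3 * t) * 10 ^ s
  expand : ∀ x₁ x₂ x₃ P A q → (x₁ + x₂ + x₃) * P * A * (10 * (10 * (10 * q)))
         ≡ x₁ * P * A * 1000 * q + x₂ * P * A * 1000 * q + x₃ * P * A * (10 * (10 * (10 * q)))
  expand = solve-∀
  collect : ∀ K q w → K * 343 * q + K * 343 * q + K * w ≡ K * (686 * q + w)
  collect = solve-∀

-- An isolated triangle triples the count while deleting 3 vertices and one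
-- triangle of the matching:  3 (7/10)^3 ≤ 3 · (10/7)^(-3)  exactly.
triangle-step : ∀ {s t x y} → Within s t 3 y → x ≤ 3 * y → MisBound s (suc t) x
triangle-step {s} {t} {x} {y} h x≤3y = subst (λ e → x * 7 ^ s * 10 ^ e ≤ 3 ^ suc t * 7 ^ e * 10 ^ s)
                                             (sym (*-suc 3 t)) (begin
    x * 7 ^ s * (10 * (10 * (10 * 10 ^ (3 * t))))
  ≤⟨ *-monoˡ-≤ _ (*-monoˡ-≤ (7 ^ s) x≤3y) ⟩
    3 * y * 7 ^ s * (10 * (10 * (10 * 10 ^ (3 * t))))
  ≡⟨ regroup₁ y (7 ^ s) (10 ^ (3 * t)) ⟩
    3 * (y * 7 ^ s * 10 ^ (3 * t) * 1000)
  ≤⟨ *-monoʳ-≤ 3 h ⟩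
    3 * (3 ^ t * 7 ^ (3 * t) * 10 ^ s * 343)
  ≡⟨ regroup₂ (3 ^ t) (7 ^ (3 * t)) (10 ^ s) ⟩
    3 * 3 ^ t * (7 * (7 * (7 * 7 ^ (3 * t)))) * 10 ^ s ∎)
  where
  open ≤-Reasoning
  regroup₁ : ∀ y p q → 3 * y * p * (10 * (10 * (10 * q))) ≡ 3 * (y * p * q * 1000)
  regroup₁ = solve-∀
  regroup₂ : ∀ a b c → 3 * (a * b * c * 343) ≡ 3 * a * (7 * (7 * (7 * b))) * c
  regroup₂ = solve-∀

-- The empty vertex set: at most one MIS, and 1 ≤ 3^t (10/7)^(−3t) as 1000 ≤ 3 · 343.
misBound-empty : ∀ t x → x ≤ 1 → MisBound 0 t x
misBound-empty t x x≤1 = begin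
    x * 1 * 10 ^ (3 * t)
  ≤⟨ *-monoˡ-≤ (10 ^ (3 * t)) (*-monoˡ-≤ 1 x≤1) ⟩
    1 * 1 * 10 ^ (3 * t)
  ≡⟨ trans (*-identityˡ _) (sym (^-*-assoc 10 3 t)) ⟩
    1000 ^ t
  ≤⟨ ^-monoˡ-≤ t (≤ᵇ⇒≤ 1000 1029 tt) ⟩
    (3 * 343) ^ t
  ≡⟨ ^-distrib-* 3 343 t ⟩
    3 ^ t * 343 ^ t
  ≡⟨ cong (3 ^ t *_) (^-*-assoc 7 3 t) ⟩
    3 ^ t * 7 ^ (3 * t)
  ≡⟨ *-identityʳ _ ⟨
    3 ^ t * 7 ^ (3 * t) * 1 ∎
  where open ≤-Reasoning

misBound-≤ : ∀ {s t x y} → x ≤ y → MisBound s t y → MisBound s t x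
misBound-≤ {s} {t} x≤y = ≤-trans (*-monoˡ-≤ (10 ^ (3 * t)) (*-monoˡ-≤ (7 ^ s) x≤y))

within-≤ : ∀ {s t r x y} → x ≤ y → Within s t r y → Within s t r x
within-≤ {s} {t} {r} x≤y = ≤-trans (*-monoˡ-≤ (10 ^ r) (*-monoˡ-≤ (10 ^ (3 * t)) (*-monoˡ-≤ (7 ^ s) x≤y)))

module MisInduction {n : ℕ} (G : Graph n) where
  open InducedMIS G

  Claim : VSet n → ℕ → Set
  Claim U t = MisBound (size U) t (misIn U)

  module Step (N : ℕ) (IH : ∀ W t′ → size W ≤ N → ItmBound W t′ → Claim W t′)
              (U : VSet n) (t : ℕ) (|U|≤1+N : size U ≤ suc N) (itm-U : ItmBound U t) where

    s : ℕ
    s = size U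

    IH-below : ∀ W t′ r → size W + suc r ≤ s → ItmBound W t′ → Claim W t′
    IH-below W t′ r small = IH W t′ (≤-pred (<-≤-trans (m<m+n (size W) (s≤s z≤n)) (≤-trans small |U|≤1+N)))

    budget : ∀ W x r → (∀ i → W ∋ i → U ∋ i) → size W + suc r ≤ s → x ≤ misIn W → Within s t (suc r) x
    budget W x r W⊆U small x≤ = within-≤ {s} {t} {suc r} {x} {misIn W} x≤
      (within-shrink {size W} {s} {t} {misIn W} (suc r) (IH-below W t r small (itmBound-⊆ U W t W⊆U itm-U)) small)

    containing : Fin n → VSet n → Bool
    containing u S = isMisIn U S ∧ lookup S u

    #containing : ∀ u → countSubsets (containing u) ≤ misIn (U ∖N[ u ])
    #containing u = count-containing U u (containing u) λ S p →
      isMisIn-sound U S (T-∧-fst {isMisIn U S} p) , T-∧-snd {isMisIn U S} p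

    branch : ∀ u r → U ∋ u → r ≤ deg U u → Within s t (suc r) (countSubsets (containing u))
    branch u r u∈U r≤deg = budget (U ∖N[ u ]) _ r (∖N-⊆ U u) (size-∖N-≤ U u r u∈U r≤deg) (#containing u)

    -- Every MIS of G[U] contains v or a neighbour of v; with N(v) ∩ U ⊆ {p, q} this
    -- splits the MISs into three (overlapping) classes.
    three-way : ∀ v p q → U ∋ v → (∀ w → U ∋ w → v ~ w → w ≡ p ⊎ w ≡ q) →
                misIn U ≤ countSubsets (containing v) + countSubsets (containing p) + countSubsets (containing q)
    three-way v p q v∈U N-v = count-∪₃ (isMisIn U) (containing v) (containing p) (containing q) classify
      where
      classify : ∀ S → T (isMisIn U S) → T (containing v S) ⊎ T (containing p S) ⊎ T (containing q S)
      classify S m with T? (lookup S v)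
      ... | yes v∈S = inj₁ (T-∧-intro m v∈S)
      ... | no  v∉S with dom (isMisIn-sound U S m) v v∈U v∉S
      ...   | w , w∈S , v~w with N-v w (sub (isMisIn-sound U S m) w w∈S) v~w
      ...     | inj₁ refl = inj₂ (inj₁ (T-∧-intro m w∈S))
      ...     | inj₂ refl = inj₂ (inj₂ (T-∧-intro m w∈S))

    -- v of minimum degree d ≠ 2: branch on the vertex of N[v] in S,
    -- d+1 branches each deleting at least d+1 vertices.
    generic-case : ∀ v → U ∋ v → (∀ w → U ∋ w → deg U v ≤ deg U w) → deg U v ≢ 2 → Claim U t
    generic-case v v∈U minimal d≢2 =
      misBound-≤ {s} {t} (count-⋃ (isMisIn U) branchAt covered)
                 (combine-uniform {n} {s} {t} (λ u → countSubsets (branchAt u)) N[v] d d≢2 card-N[v] within outside)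
      where
      d : ℕ
      d = deg U v
      N[v] : Fin n → Bool
      N[v] u = lookup U u ∧ not (lookup (U ∖N[ v ]) u)
      N[v]-intro : ∀ u → U ∋ u → u ≡ v ⊎ v ~ u → T (N[v] u)
      N[v]-intro u u∈U near = T-∧-intro u∈U (T-not-intro λ p → far (∖N-elim U v u p) near)
        where far : U ∋ u × u ≢ v × ¬ v ~ u → ¬ (u ≡ v ⊎ v ~ u)
              far (_ , u≢v , _) (inj₁ u≡v) = u≢v u≡v
              far (_ , _ , v≁u) (inj₂ v~u) = v≁u v~u
      card-N[v] : card N[v] ≡ suc d
      card-N[v] = +-cancelˡ-≡ (size (U ∖N[ v ])) _ _
        (trans (sym (size-⊆ U (U ∖N[ v ]) (∖N-⊆ U v))) (sym (size-∖N U v v∈U)))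
      branchAt : Fin n → VSet n → Bool
      branchAt u S = N[v] u ∧ containing u S
      covered : ∀ S → T (isMisIn U S) → ∃ λ u → T (branchAt u S)
      covered S m with T? (lookup S v)
      ... | yes v∈S = v , T-∧-intro (N[v]-intro v v∈U (inj₁ refl)) (T-∧-intro m v∈S)
      ... | no  v∉S with dom (isMisIn-sound U S m) v v∈U v∉S
      ...   | w , w∈S , v~w = w , T-∧-intro (N[v]-intro w (sub (isMisIn-sound U S m) w w∈S) (inj₂ v~w)) (T-∧-intro m w∈S)
      within : ∀ u → T (N[v] u) → Within s t (suc d) (countSubsets (branchAt u))
      within u p = within-≤ {s} {t} {suc d} (count-mono (branchAt u) (containing u) λ S q → T-∧-snd {N[v] u} q) (branch u d u∈U (minimal u u∈U))
        where u∈U = T-∧-fst {lookup U u} p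
      outside : ∀ u → ¬ T (N[v] u) → countSubsets (branchAt u) ≡ 0
      outside u u∉N[v] = count-none (branchAt u) λ S q → u∉N[v] (T-∧-fst {N[v] u} q)

    -- deg v = 2 with N(v) = {p, q} and deg q ≥ 3: branches deleting 3, 3 and 4 vertices.
    heavy-neighbour-case : ∀ v p q → U ∋ v → U ∋ p → U ∋ q → (∀ w → U ∋ w → v ~ w → w ≡ p ⊎ w ≡ q) →
                           2 ≤ deg U v → 2 ≤ deg U p → 3 ≤ deg U q → Claim U t
    heavy-neighbour-case v p q v∈U p∈U q∈U N-v deg-v deg-p deg-q =
      misBound-≤ {s} {t} (three-way v p q v∈U N-v)
                 (combine₃ {s} {t} 1 (countSubsets (containing v)) (countSubsets (containing p)) (countSubsets (containing q))
                          (≤ᵇ⇒≤ _ _ tt) (branch v 2 v∈U deg-v) (branch p 2 p∈U deg-p) (branch q 3 q∈U deg-q))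

    -- Each MIS
    -- contains one corner and then restricts to a MIS of G[U ∖ N[v]], whose induced
    -- triangle matchings are one smaller:  mis(G[U]) ≤ 3 mis(G[U ∖ N[v]]).
    triangle-case : ∀ v x y → U ∋ v → U ∋ x → U ∋ y → v ~ x → v ~ y → x ~ y →
                    deg U v ≡ 2 → deg U x ≡ 2 → deg U y ≡ 2 → Claim U t
    triangle-case v x y v∈U x∈U y∈U v~x v~y x~y deg-v deg-x deg-y =
      subst (Claim U) (sym t≡1+t′) (triangle-step {s} {t′} {misIn U} {misIn (U ∖N[ v ])} rest-within three-corners)
      where
      N-v : ∀ w → U ∋ w → v ~ w → w ≡ x ⊎ w ≡ y
      N-v = two-neighbours U v x y x∈U y∈U v~x v~y (~-distinct (~-sym x~y)) deg-v
      N-x : ∀ w → U ∋ w → x ~ w → w ≡ v ⊎ w ≡ y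
      N-x = two-neighbours U x v y v∈U y∈U (~-sym v~x) x~y (~-distinct (~-sym v~y)) deg-x
      N-y : ∀ w → U ∋ w → y ~ w → w ≡ v ⊎ w ≡ x
      N-y = two-neighbours U y v x v∈U x∈U (~-sym v~y) (~-sym x~y) (~-distinct (~-sym v~x)) deg-y
      reduced : ∃ λ t′ → t ≡ suc t′ × ItmBound (U ∖N[ v ]) t′
      reduced = TriangleComponent.itmBound-∖N U v x y v∈U x∈U y∈U v~x v~y x~y N-x N-y t itm-U
      t′ : ℕ
      t′ = proj₁ reduced
      t≡1+t′ : t ≡ suc t′
      t≡1+t′ = proj₁ (proj₂ reduced)
      |rest|+3≤s : size (U ∖N[ v ]) + 3 ≤ s
      |rest|+3≤s = size-∖N-≤ U v 2 v∈U (≤-reflexive (sym deg-v))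
      rest-within : Within s t′ 3 (misIn (U ∖N[ v ]))
      rest-within = within-shrink {size (U ∖N[ v ])} {s} {t′} {misIn (U ∖N[ v ])} 3
                      (IH-below (U ∖N[ v ]) t′ 2 |rest|+3≤s (proj₂ (proj₂ reduced))) |rest|+3≤s
      three-corners : misIn U ≤ 3 * misIn (U ∖N[ v ])
      three-corners = begin
          misIn U
        ≤⟨ three-way v x y v∈U N-v ⟩
          countSubsets (containing v) + countSubsets (containing x) + countSubsets (containing y)
        ≤⟨ +-mono-≤ (+-mono-≤ (#containing v)
                              (≤-trans (#containing x) (∖N-triangle U v x y v~x v~y x~y N-v N-x)))
                    (≤-trans (#containing y) (∖N-triangle U v y x v~y v~x (~-sym x~y) (λ w w∈U v~w → swap (N-v w w∈U v~w)) N-y)) ⟩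
          misIn (U ∖N[ v ]) + misIn (U ∖N[ v ]) + misIn (U ∖N[ v ])
        ≡⟨ thrice (misIn (U ∖N[ v ])) ⟩
          3 * misIn (U ∖N[ v ]) ∎
        where
        open ≤-Reasoning
        thrice : ∀ m → m + m + m ≡ 3 * m
        thrice = solve-∀

    -- The MISs containing both y and z, where deg y ≥ 2 and z has a neighbour x ∉ N[y]:
    -- deleting N[y] and then N[z] removes at least 3 + 2 vertices.
    pair-branch : ∀ x y z (R : VSet n → Bool) → U ∋ x → U ∋ y → U ∋ z → x ≢ y → ¬ x ~ y → x ~ z → z ≢ y →
                  2 ≤ deg U y → (∀ S → T (R S) → IsMisIn U S × S ∋ y × S ∋ z) → Within s t 5 (countSubsets R)
    pair-branch x y z R x∈U y∈U z∈U x≢y x≁y x~z z≢y deg-y contains with T? (adj G y z)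
    ... | yes y~z rewrite count-none R (λ S q → let (m , y∈S , z∈S) = contains S q in ind m y z y∈S z∈S y~z) = z≤n
    ... | no  y≁z = budget W₂ _ 4 W₂⊆U |W₂|+5≤s (count-containing₂ U y z R z≢y contains)
      where
      W₁ = U ∖N[ y ]
      W₂ = W₁ ∖N[ z ]
      W₂⊆U : ∀ i → W₂ ∋ i → U ∋ i
      W₂⊆U i p = ∖N-⊆ U y i (∖N-⊆ W₁ z i p)
      z∈W₁ : W₁ ∋ z
      z∈W₁ = ∖N-intro U y z z∈U z≢y y≁z
      x∈W₁ : W₁ ∋ x
      x∈W₁ = ∖N-intro U y x x∈U x≢y (x≁y ∘ ~-sym)
      |W₂|+5≤s : size W₂ + 5 ≤ s
      |W₂|+5≤s = begin
          size W₂ + 5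
        ≡⟨ +-assoc (size W₂) 2 3 ⟨
          size W₂ + 2 + 3
        ≤⟨ +-monoˡ-≤ 3 (size-∖N-≤ W₁ z 1 z∈W₁ (deg-pos W₁ z x x∈W₁ (~-sym x~z))) ⟩
          size W₁ + 3
        ≤⟨ size-∖N-≤ U y 2 y∈U deg-y ⟩
          s ∎
        where open ≤-Reasoning

    -- deg x = 2 with N(v) = {x, y}, x ≁ y, and N(x) = {v, z}.  A MIS contains x, or v,
    -- or neither, and then (domination of v and x) both y and z: branches deleting
    -- 3, 3 and 5 vertices.
    path-case : ∀ v x y → U ∋ v → U ∋ x → U ∋ y → v ~ x → ¬ x ~ y → x ≢ y →
                (∀ w → U ∋ w → v ~ w → w ≡ x ⊎ w ≡ y) →
                2 ≤ deg U v → deg U x ≡ 2 → 2 ≤ deg U y → Claim U t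
    path-case v x y v∈U x∈U y∈U v~x x≁y x≢y N-v deg-v deg-x deg-y with other-neighbour U x v v∈U (~-sym v~x) deg-x
    ... | z , z∈U , x~z , _ , N-x =
      misBound-≤ {s} {t} classes
        (combine₃ {s} {t} 2 (countSubsets (containing x)) (countSubsets (containing v)) (countSubsets neither)
                  (≤ᵇ⇒≤ _ _ tt) (branch x 2 x∈U (≤-reflexive (sym deg-x))) (branch v 2 v∈U deg-v)
                  (pair-branch x y z neither x∈U y∈U z∈U x≢y x≁y x~z z≢y deg-y neither-contains))
      where
      z≢y : z ≢ y
      z≢y refl = x≁y x~z
      neither : VSet n → Bool
      neither S = isMisIn U S ∧ (not (lookup S x) ∧ not (lookup S v))
      classes : misIn U ≤ countSubsets (containing x) + countSubsets (containing v) + countSubsets neither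
      classes = count-∪₃ (isMisIn U) (containing x) (containing v) neither classify
        where
        classify : ∀ S → T (isMisIn U S) → T (containing x S) ⊎ T (containing v S) ⊎ T (neither S)
        classify S m with T? (lookup S x) | T? (lookup S v)
        ... | yes x∈S | _       = inj₁ (T-∧-intro m x∈S)
        ... | no  _   | yes v∈S = inj₂ (inj₁ (T-∧-intro m v∈S))
        ... | no  x∉S | no  v∉S = inj₂ (inj₂ (T-∧-intro m (T-∧-intro (T-not-intro x∉S) (T-not-intro v∉S))))
      neither-contains : ∀ S → T (neither S) → IsMisIn U S × S ∋ y × S ∋ z
      neither-contains S q = m , forced-neighbour U S v x y m v∈U N-v v∉S x∉S , forced-neighbour U S x v z m x∈U N-x x∉S v∉S
        where
        m : IsMisIn U S
        m = isMisIn-sound U S (T-∧-fst {isMisIn U S} q)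
        avoid = T-∧-snd {isMisIn U S} q
        x∉S : ¬ S ∋ x
        x∉S = T-not-elim (T-∧-fst {not (lookup S x)} avoid)
        v∉S : ¬ S ∋ v
        v∉S = T-not-elim (T-∧-snd {not (lookup S x)} avoid)

    -- v of minimum degree 2 with N(v) = {x, y}: a neighbour of degree ≥ 3, an
    -- isolated triangle, or an induced path through x, v, y.
    degree-two-case : ∀ v x y → U ∋ v → U ∋ x → U ∋ y → v ~ x → v ~ y → y ≢ x →
                      (∀ w → U ∋ w → v ~ w → w ≡ x ⊎ w ≡ y) →
                      (∀ w → U ∋ w → deg U v ≤ deg U w) → deg U v ≡ 2 → Claim U t
    degree-two-case v x y v∈U x∈U y∈U v~x v~y y≢x N-v minimal deg-v =
      by-cases (3 ≤? deg U x) (3 ≤? deg U y) (T? (adj G x y))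
      where
      two≤v : 2 ≤ deg U v
      two≤v = ≤-reflexive (sym deg-v)
      two≤ : ∀ w → U ∋ w → 2 ≤ deg U w
      two≤ w w∈U = ≤-trans two≤v (minimal w w∈U)
      exactly-two : ∀ w → U ∋ w → ¬ 3 ≤ deg U w → deg U w ≡ 2
      exactly-two w w∈U light = ≤-antisym (≤-pred (≰⇒> light)) (two≤ w w∈U)
      by-cases : Dec (3 ≤ deg U x) → Dec (3 ≤ deg U y) → Dec (x ~ y) → Claim U t
      by-cases (yes x-heavy) _ _ =
        heavy-neighbour-case v y x v∈U y∈U x∈U (λ w w∈U v~w → swap (N-v w w∈U v~w)) two≤v (two≤ y y∈U) x-heavy
      by-cases (no _) (yes y-heavy) _ =
        heavy-neighbour-case v x y v∈U x∈U y∈U N-v two≤v (two≤ x x∈U) y-heavy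
      by-cases (no x-light) (no y-light) (yes x~y) =
        triangle-case v x y v∈U x∈U y∈U v~x v~y x~y deg-v (exactly-two x x∈U x-light) (exactly-two y y∈U y-light)
      by-cases (no x-light) (no _) (no x≁y) =
        path-case v x y v∈U x∈U y∈U v~x x≁y (y≢x ∘ sym) N-v two≤v (exactly-two x x∈U x-light) (two≤ y y∈U)

    step : size U ≢ 0 → Claim U t
    step nonempty with argmin (lookup U) (deg U)
    ... | inj₁ empty = let (i , i∈U) = card-nonzero (lookup U) nonempty in ⊥-elim (empty i i∈U)
    ... | inj₂ (v , v∈U , minimal) with deg U v ≟ 2
    ...   | no  d≢2  = generic-case v v∈U minimal d≢2
    ...   | yes deg-v with card-nonzero (λ w → lookup U w ∧ adj G v w) (subst (_≢ 0) (sym deg-v) λ ())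
    ...     | x , Nx with other-neighbour U v x (T-∧-fst {lookup U x} Nx) (T-∧-snd {lookup U x} Nx) deg-v
    ...       | y , y∈U , v~y , y≢x , N-v =
      degree-two-case v x y v∈U (T-∧-fst {lookup U x} Nx) y∈U (T-∧-snd {lookup U x} Nx) v~y y≢x N-v minimal deg-v

  misIn-bound : ∀ N U t → size U ≤ N → ItmBound U t → Claim U t
  misIn-bound N U t |U|≤N itm-U with size U ≟ 0
  ... | yes |U|≡0 = subst (λ k → MisBound k t (misIn U)) (sym |U|≡0) (misBound-empty t (misIn U) (misIn-empty U |U|≡0))
  misIn-bound zero    U t |U|≤N itm-U | no nonempty = ⊥-elim (nonempty (n≤0⇒n≡0 |U|≤N))
  misIn-bound (suc N) U t |U|≤N itm-U | no nonempty = Step.step N (misIn-bound N) U t |U|≤N itm-U nonempty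

itm-deficit : ∀ n t en ed → 3 * t * ed < (ed ∸ en) * n → ∃ λ m → n ≡ 3 * t + m × en * n < m * ed
itm-deficit n t en ed h = m , sym n≡3t+m , en·n<m·ed
  where
  open ≤-Reasoning
  3t·ed<n·ed : 3 * t * ed < n * ed
  3t·ed<n·ed = <-≤-trans h (≤-trans (*-monoˡ-≤ n (m∸n≤m ed en)) (≤-reflexive (*-comm ed n)))
  m = n ∸ 3 * t
  n≡3t+m : 3 * t + m ≡ n
  n≡3t+m = m+[n∸m]≡n (<⇒≤ (*-cancelʳ-< ed (3 * t) n 3t·ed<n·ed))
  -- en > ed would make the hypothesis read 3t·ed < 0.
  en≤ed : en ≤ ed
  en≤ed with en ≤? ed
  ... | yes p = p
  ... | no  p = ⊥-elim (n≮0 (subst (3 * t * ed <_) (cong (_* n) (m≤n⇒m∸n≡0 (<⇒≤ (≰⇒> p)))) h))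
  en·n<m·ed : en * n < m * ed
  en·n<m·ed = +-cancelʳ-< (3 * t * ed) (en * n) (m * ed) (begin-strict
      en * n + 3 * t * ed
    <⟨ +-monoʳ-< (en * n) h ⟩
      en * n + (ed ∸ en) * n
    ≡⟨ *-distribʳ-+ n en (ed ∸ en) ⟨
      (en + (ed ∸ en)) * n
    ≡⟨ cong (_* n) (m+[n∸m]≡n en≤ed) ⟩
      ed * n
    ≡⟨ cong (ed *_) (sym n≡3t+m) ⟩
      ed * (3 * t + m)
    ≡⟨ regroup ed t m ⟩
      m * ed + 3 * t * ed ∎)
    where regroup : ∀ ed t m → ed * (3 * t + m) ≡ m * ed + 3 * t * ed
          regroup = solve-∀

misBound-per-vertex : ∀ x t m → MisBound (3 * t + m) t x → x * 7 ^ m ≤ 3 ^ t * 10 ^ m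
misBound-per-vertex x t m h = *-cancelʳ-≤ _ _ (7 ^ (3 * t) * 10 ^ (3 * t)) {{nonZero}} (begin
    x * 7 ^ m * (7 ^ (3 * t) * 10 ^ (3 * t))
  ≡⟨ regroup₁ x (7 ^ m) (7 ^ (3 * t)) (10 ^ (3 * t)) ⟩
    x * (7 ^ (3 * t) * 7 ^ m) * 10 ^ (3 * t)
  ≡⟨ cong (λ z → x * z * 10 ^ (3 * t)) (^-distribˡ-+-* 7 (3 * t) m) ⟨
    x * 7 ^ (3 * t + m) * 10 ^ (3 * t)
  ≤⟨ h ⟩
    3 ^ t * 7 ^ (3 * t) * 10 ^ (3 * t + m)
  ≡⟨ cong (3 ^ t * 7 ^ (3 * t) *_) (^-distribˡ-+-* 10 (3 * t) m) ⟩
    3 ^ t * 7 ^ (3 * t) * (10 ^ (3 * t) * 10 ^ m)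
  ≡⟨ regroup₂ (3 ^ t) (7 ^ (3 * t)) (10 ^ (3 * t)) (10 ^ m) ⟩
    3 ^ t * 10 ^ m * (7 ^ (3 * t) * 10 ^ (3 * t)) ∎)
  where
  open ≤-Reasoning
  nonZero : NonZero (7 ^ (3 * t) * 10 ^ (3 * t))
  nonZero = m*n≢0 _ _ {{m^n≢0 7 (3 * t)}} {{m^n≢0 10 (3 * t)}}
  regroup₁ : ∀ x p q r → x * p * (q * r) ≡ x * (q * p) * r
  regroup₁ = solve-∀
  regroup₂ : ∀ a b c d → a * b * (c * d) ≡ a * d * (b * c)
  regroup₂ = solve-∀

-- 8 · 1000^73 ≤ 1029^73 (i.e. 73 log(1029/1000) ≥ 3, where 1029 = 3 · 7^3), raised
-- to the power K:  10^(219K) 2^(3K) ≤ 3^(73K) 7^(219K).  This is where c = 1/73 comes from.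
numerical-gap : ∀ K → 10 ^ (3 * (73 * K)) * 2 ^ (3 * K) ≤ 3 ^ (73 * K) * 7 ^ (3 * (73 * K))
numerical-gap K = begin
    10 ^ (3 * (73 * K)) * 2 ^ (3 * K)
  ≡⟨ cong₂ _*_ (sym (^-*-assoc 10 3 (73 * K))) (sym (^-*-assoc 2 3 K)) ⟩
    1000 ^ (73 * K) * 8 ^ K
  ≡⟨ cong (_* 8 ^ K) (sym (^-*-assoc 1000 73 K)) ⟩
    (1000 ^ 73) ^ K * 8 ^ K
  ≡⟨ ^-distrib-* (1000 ^ 73) 8 K ⟨
    (1000 ^ 73 * 8) ^ K
  ≤⟨ ^-monoˡ-≤ K (≤ᵇ⇒≤ _ _ tt) ⟩
    (1029 ^ 73) ^ K
  ≡⟨ ^-*-assoc 1029 73 K ⟩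
    (3 * 343) ^ (73 * K)
  ≡⟨ ^-distrib-* 3 343 (73 * K) ⟩
    3 ^ (73 * K) * 343 ^ (73 * K)
  ≡⟨ cong (3 ^ (73 * K) *_) (^-*-assoc 7 3 (73 * K)) ⟩
    3 ^ (73 * K) * 7 ^ (3 * (73 * K)) ∎
  where open ≤-Reasoning

per-vertex-power : ∀ x t m k → x * 7 ^ m ≤ 3 ^ t * 10 ^ m → x ^ k * 7 ^ (m * k) ≤ 3 ^ (t * k) * 10 ^ (m * k)
per-vertex-power x t m k per-vertex = begin
    x ^ k * 7 ^ (m * k)
  ≡⟨ cong (x ^ k *_) (^-*-assoc 7 m k) ⟨
    x ^ k * (7 ^ m) ^ k
  ≡⟨ ^-distrib-* x (7 ^ m) k ⟨
    (x * 7 ^ m) ^ k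
  ≤⟨ ^-monoˡ-≤ k per-vertex ⟩
    (3 ^ t * 10 ^ m) ^ k
  ≡⟨ ^-distrib-* (3 ^ t) (10 ^ m) k ⟩
    (3 ^ t) ^ k * (10 ^ m) ^ k
  ≡⟨ cong₂ _*_ (^-*-assoc 3 t k) (^-*-assoc 10 m k) ⟩
    3 ^ (t * k) * 10 ^ (m * k) ∎
  where open ≤-Reasoning

-- If x ≤ 3^t (10/7)^m and en·n < m·ed for n = 3t + m, then
-- log x < (log 3 / 3 − en/(73 ed)) n, in the cleared form of the statement.
log-bound : ∀ x t m en ed → x * 7 ^ m ≤ 3 ^ t * 10 ^ m → en * (3 * t + m) < m * ed →
            x ^ (3 * (73 * ed)) * 2 ^ (3 * en * (3 * t + m)) < 3 ^ ((73 * ed) * (3 * t + m))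
log-bound x t m en ed per-vertex deficit = *-cancelʳ-< B _ _ (begin-strict
    x ^ (3 * E) * 2 ^ (3 * en * n) * B
  ≡⟨ *-comm-middle (x ^ (3 * E)) (2 ^ (3 * en * n)) B ⟩
    x ^ (3 * E) * B * 2 ^ (3 * en * n)
  ≤⟨ *-monoˡ-≤ (2 ^ (3 * en * n)) (per-vertex-power x t m (3 * E) per-vertex) ⟩
    (T₃ * Z) * 2 ^ (3 * en * n)
  <⟨ *-monoʳ-< (T₃ * Z) (^-monoʳ-< 2 (s≤s (s≤s z≤n)) exponent) ⟩
    (T₃ * Z) * 2 ^ (3 * K)
  ≡⟨ *-assoc T₃ Z (2 ^ (3 * K)) ⟩
    T₃ * (Z * 2 ^ (3 * K))
  ≤⟨ *-monoʳ-≤ T₃ gap ⟩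
    T₃ * (3 ^ (m * E) * B)
  ≡⟨ *-assoc T₃ (3 ^ (m * E)) B ⟨
    (T₃ * 3 ^ (m * E)) * B
  ≡⟨ cong (_* B) (trans (sym (^-distribˡ-+-* 3 (t * (3 * E)) (m * E))) (cong (3 ^_) (exponents t m E))) ⟩
    3 ^ (E * n) * B ∎)
  where
  open ≤-Reasoning
  E = 73 * ed
  n = 3 * t + m
  K = m * ed
  B = 7 ^ (m * (3 * E))
  T₃ = 3 ^ (t * (3 * E))
  Z = 10 ^ (m * (3 * E))
  instance
    nonZeroTZ : NonZero (T₃ * Z)
    nonZeroTZ = m*n≢0 _ _ {{m^n≢0 3 (t * (3 * E))}} {{m^n≢0 10 (m * (3 * E))}}
  exponent : 3 * en * n < 3 * K
  exponent = subst (_< 3 * K) (sym (*-assoc 3 en n)) (*-monoʳ-< 3 deficit)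
  gap : Z * 2 ^ (3 * K) ≤ 3 ^ (m * E) * B
  gap = subst₂ (λ a b → 10 ^ a * 2 ^ (3 * K) ≤ 3 ^ b * 7 ^ a)
               (sym (triple m ed)) (single m ed) (numerical-gap K)
    where triple : ∀ m ed → m * (3 * (73 * ed)) ≡ 3 * (73 * (m * ed))
          triple = solve-∀
          single : ∀ m ed → 73 * (m * ed) ≡ m * (73 * ed)
          single = solve-∀
  *-comm-middle : ∀ a b c → a * b * c ≡ a * c * b
  *-comm-middle = solve-∀
  exponents : ∀ t m E → t * (3 * E) + m * E ≡ E * (3 * t + m)
  exponents = solve-∀

deficit⇒log-bound : ∀ x n t en ed → MisBound n t x → 3 * t * ed < (ed ∸ en) * n →
                    x ^ (3 * (73 * ed)) * 2 ^ (3 * en * n) < 3 ^ ((73 * ed) * n)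
deficit⇒log-bound x n t en ed bound deficit with itm-deficit n t en ed deficit
... | m , refl , en·n<m·ed = log-bound x t m en ed (misBound-per-vertex x t m bound) en·n<m·ed

mis-bound : ∀ {n} (G : Graph n) t → IsItm G t → MisBound n t (mis G)
mis-bound {n} G t itm =
  misBound-≤ {n} {t} mis≤misIn-full
    (subst (λ k → MisBound k t (misIn full)) size-full
      (misIn-bound (size full) full t ≤-refl (itmBound-full t itm)))
  where
  open InducedMIS G
  open MisInduction G

theorem1p3 : Σ ℕ λ cn → Σ ℕ λ cd → 0 < cn × 0 < cd ×
    ((en ed : ℕ) → 0 < en → 0 < ed →
    Σ ℕ λ dn → Σ ℕ λ dd → 0 < dd × cn * en * dd ≤ dn * cd * ed ×
    ((n : ℕ) (G : Graph n) (t : ℕ) → IsItm G t →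
    3 * t * ed < (ed ∸ en) * n →
    mis G ^ (3 * dd) * 2 ^ (3 * dn * n) < 3 ^ (dd * n)))
theorem1p3 = 1 , 73 , s≤s z≤n , s≤s z≤n , λ en ed _ 0<ed →
  en , 73 * ed , ≤-trans 0<ed (m≤n*m ed 73) , ≤-reflexive (c·ε≡δ en ed) ,
  λ n G t itm deficit → deficit⇒log-bound (mis G) n t en ed (mis-bound G t itm) deficit
  where
  -- With c = 1/73 and δ = en/(73 ed) the requirement δ ≥ c ε holds with equality.
  c·ε≡δ : ∀ en ed → 1 * en * (73 * ed) ≡ en * 73 * ed
  c·ε≡δ = solve-∀
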